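{- Let $(G,R)$ be a rooted graph and $\sim$ a non-edge-collapsing equivalence relation on $G$ such that the rooted quotient graph $(G/\sim,[R]_\sim)$ admits an actual labelling. Then $(G,R)$ admits an actual labelling.
   Context: Graphs are directed multigraphs $G=(VG,EG,o,t)$. A rooted graph $(G,R)$ has every vertex reachable from $R$ by a directed path. A graph equivalence relation on $G$ is an equivalence relation on $VG$ together with one on $EG$ such that $e\sim f$ implies $o(e)\sim o(f)$ and $t(e)\sim t(f)$; the quotient $G/\sim$ has vertices and edges the equivalence classes with $o([e])=[o(e)]$, $t([e])=[t(e)]$. It is non-edge-collapsing (n.e.c.) if for all vertices $v\sim w$ there are bijections $\pi_{v,w}:o^{ -1}(v)\to o^{ -1}(w)$ with $e\sim f\iff o(e)\sim o(f)$ and $\pi_{o(e),o(f)}(e)=f$. Multisets over $X$ have positive integer multiplicities; union adds multiplicities; $M\setminus\{x\}$ removes one copy. $t_m(o^{ -1}(v))$ is the multiset of termini of edges leaving $v$ counted with the number of edges; $l(t_m(o^{ -1}(v)))$ its multiset of labels. Actual labelling of a rooted graph $(G,R)$ with $t^{ -1}(R)=\emptyset$: a finite set $X$, maps $l:VG\to X$, $l_p:VG\setminus\{R\}\to X$, and multisets $M_x$ ($x\in X$) such that for all $v\neq R$: (1) $l_p(v)\in M_{l(v)}$; (2) $l(t_m(o^{ -1}(v)))=M_{l(v)}\setminus\{l_p(v)\}$; (3) $l(o(e))=l_p(v)$ for all edges $e$ with $t(e)=v$; and (4) $l(t_m(o^{ -1}(R)))=M_{l(R)}$. -}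

module Defs where

open import Data.Nat using (ℕ; _∸_; _≤_)
open import Data.Fin using (Fin; _≟_)
open import Data.Product using (Σ; _×_; _,_; proj₁)
open import Relation.Nullary using (¬_; yes; no)
open import Relation.Binary using (Setoid; IsEquivalence)
open import Relation.Binary.PropositionalEquality using (_≡_; refl; isEquivalence)
import Relation.Binary.Construct.On as On
open import Function.Bundles using (Bijection)
import Relation.Binary.PropositionalEquality as P

record Graph : Set₁ where
  field
    V : Set
    E : Set
    o : E → V
    t : E → V

module _ (G : Graph) where
  open Graph G

  data Reach (R : V) : V → Set where
    here : Reach R R
    step : (e : E) → Reach R (o e) → Reach R (t e)

  Rooted : V → Set
  Rooted R = ∀ v → Reach R v

record GraphEquiv (G : Graph) : Set₁ where
  open Graph G
  field
    _≈V_   : V → V → Set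
    _≈E_   : E → E → Set
    isEqV  : IsEquivalence _≈V_
    isEqE  : IsEquivalence _≈E_
    o-cong : ∀ {e f} → e ≈E f → o e ≈V o f
    t-cong : ∀ {e f} → e ≈E f → t e ≈V t f

discrete : (G : Graph) → GraphEquiv G
discrete G = record
  { _≈V_ = _≡_ ; _≈E_ = _≡_ ; isEqV = isEquivalence ; isEqE = isEquivalence
  ; o-cong = P.cong (Graph.o G) ; t-cong = P.cong (Graph.t G) }

module _ {G : Graph} (∼ : GraphEquiv G) where
  open Graph G
  open GraphEquiv ∼

  OutE : V → Set
  OutE v = Σ E (λ e → o e ≡ v)

  record NEC : Set where
    field
      π      : (v w : V) → v ≈V w → OutE v → OutE w
      -- π_{v,w} depends only on v and w (not on the proof of v ∼ w)
      π-irr  : ∀ v w (p q : v ≈V w) (a : OutE v) →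
               proj₁ (π v w p a) ≡ proj₁ (π v w q a)
      π-inj  : ∀ v w (p : v ≈V w) (a b : OutE v) →
               proj₁ (π v w p a) ≡ proj₁ (π v w p b) → proj₁ a ≡ proj₁ b
      π-surj : ∀ v w (p : v ≈V w) (b : OutE w) →
               Σ (OutE v) (λ a → proj₁ (π v w p a) ≡ proj₁ b)
      nec⇒   : ∀ e f → e ≈E f →
               Σ (o e ≈V o f) (λ p → proj₁ (π (o e) (o f) p (e , refl)) ≡ f)
      nec⇐   : ∀ e f (p : o e ≈V o f) →
               proj₁ (π (o e) (o f) p (e , refl)) ≡ f → e ≈E f

-- Finite multisets over Fin k, as multiplicity functions
-- (multiplicity 0 = not a member).

Multiset : ℕ → Set
Multiset k = Fin k → ℕ

_∈ₘ_ : ∀ {k} → Fin k → Multiset k → Set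
x ∈ₘ M = 1 ≤ M x

_∖₁_ : ∀ {k} → Multiset k → Fin k → Multiset k
(M ∖₁ x) y with y ≟ x
... | yes _ = M y ∸ 1
... | no  _ = M y

-- Vertices / edges of G/∼ are represented by vertices / edges of G up to
-- ∼ (setoid quotient).  Taking ∼ = discrete G gives actual labellings of
-- (G, R) itself.

module _ {G : Graph} (∼ : GraphEquiv G) where
  open Graph G
  open GraphEquiv ∼

  -- the setoid of edges [e] of G/∼ with o([e]) = [v] and l(t([e])) = y
  OutLabelled : ∀ {k} → (V → Fin k) → V → Fin k → Setoid _ _
  OutLabelled l v y = record
    { Carrier       = Σ E (λ e → (o e ≈V v) × (l (t e) ≡ y))
    ; _≈_           = λ a b → proj₁ a ≈E proj₁ b
    ; isEquivalence = On.isEquivalence proj₁ isEqE }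

  -- l(t_m(o⁻¹([v]))) = M  in G/∼: for every label y, the number of
  -- edges of G/∼ leaving [v] whose terminus has label y is M(y).
  OutLabelsEq : ∀ {k} → (V → Fin k) → V → Multiset k → Set
  OutLabelsEq {k} l v M =
    ∀ (y : Fin k) → Bijection (OutLabelled l v y) (P.setoid (Fin (M y)))

  record ActualLabelling (R : V) : Set₁ where
    field
      noInRoot : ∀ e → ¬ (t e ≈V R)
      k      : ℕ
      l      : V → Fin k
      l-cong : ∀ {v w} → v ≈V w → l v ≡ l w
      -- l_p, only meaningful on vertices not ∼ R (value on [R] irrelevant)
      lp      : V → Fin k
      lp-cong : ∀ {v w} → v ≈V w → lp v ≡ lp w
      M      : Fin k → Multiset k
      cond1  : ∀ v → ¬ (v ≈V R) → lp v ∈ₘ M (l v)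
      cond2  : ∀ v → ¬ (v ≈V R) → OutLabelsEq l v (M (l v) ∖₁ lp v)
      cond3  : ∀ e → ¬ (t e ≈V R) → l (o e) ≡ lp (t e)
      cond4  : OutLabelsEq l R (M (l R))

-- A non-edge-collapsing ∼ identifies the out-edges of v bijectively with the
-- out-edges of [v] in G/∼, compatibly with termini, so pulling the labelling
-- of G/∼ back along v ↦ [v] preserves every out-label count.  Conditions
-- (1)–(3) only concern vertices not ∼ R, and in a rooted graph with no edge
-- into [R] these are exactly the vertices different from R.

module Submission where

open import Defs
open import Data.Fin using (Fin)
open import Data.Product using (Σ-syntax; _,_; proj₁; proj₂)
open import Relation.Nullary using (¬_)
open import Relation.Binary using (Setoid; IsEquivalence)
open import Relation.Binary.PropositionalEquality using (_≡_; _≢_; refl; cong; sym; trans)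
open import Function.Bundles using (Bijection)
import Function.Consequences.Setoid
import Function.Construct.Composition as Composition

module _ {G : Graph} (∼ : GraphEquiv G) where
  open Graph G
  open GraphEquiv ∼

  ¬≈root : ∀ {R v} → Rooted G R → (∀ e → ¬ (t e ≈V R)) → v ≢ R → ¬ (v ≈V R)
  ¬≈root {v = v} rooted noInRoot v≢R v≈R with rooted v
  ... | here     = v≢R refl
  ... | step e _ = noInRoot e v≈R

  module NonEdgeCollapsing (nec : NEC ∼) where
    open NEC nec
    private module EE = IsEquivalence isEqE

    π-id : ∀ {v w} → v ≡ w → (p : v ≈V w) (a : OutE ∼ v) → proj₁ (π v w p a) ≡ proj₁ a
    π-id refl p (e , refl) with nec⇒ e e EE.refl
    ... | q , πe≡e = trans (π-irr (o e) (o e) p q (e , refl)) πe≡e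

    ≈E-π : ∀ e {v} (p : o e ≈V v) → e ≈E proj₁ (π (o e) v p (e , refl))
    ≈E-π e {v} p with π (o e) v p (e , refl) in πe
    ... | f , refl = nec⇐ e f p (cong proj₁ πe)

    ≈E-sameOrigin⇒≡ : ∀ {e f} → e ≈E f → o e ≡ o f → e ≡ f
    ≈E-sameOrigin⇒≡ {e} {f} e≈f oe≡of with nec⇒ e f e≈f
    ... | p , πe≡f = trans (sym (π-id oe≡of p (e , refl))) πe≡f

    module _ {k} {l : V → Fin k} (l-cong : ∀ {v w} → v ≈V w → l v ≡ l w) where

      OutLabelled-discrete⤖quotient : ∀ v y →
        Bijection (OutLabelled (discrete G) l v y) (OutLabelled ∼ l v y)
      OutLabelled-discrete⤖quotient v y = record
        { to        = include
        ; cong      = λ {a} {b} → include-cong {a} {b}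
        ; bijective = (λ {a} {b} → injective {a} {b})
                    , strictlySurjective⇒surjective {f = include}
                        (λ {a} {b} → include-cong {a} {b}) strictlySurjective
        }
        where
        open Function.Consequences.Setoid (OutLabelled (discrete G) l v y) (OutLabelled ∼ l v y)
          using (strictlySurjective⇒surjective)

        include : Setoid.Carrier (OutLabelled (discrete G) l v y) →
                  Setoid.Carrier (OutLabelled ∼ l v y)
        include (e , oe≡v , le≡y) = e , IsEquivalence.reflexive isEqV oe≡v , le≡y

        include-cong : ∀ {a b} → proj₁ a ≡ proj₁ b → proj₁ (include a) ≈E proj₁ (include b)
        include-cong refl = EE.refl

        injective : ∀ {a b} → proj₁ (include a) ≈E proj₁ (include b) → proj₁ a ≡ proj₁ b
        injective {e , oe≡v , _} {f , of≡v , _} e≈f =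
          ≈E-sameOrigin⇒≡ e≈f (trans oe≡v (sym of≡v))

        strictlySurjective : ∀ b → Σ[ a ∈ Setoid.Carrier (OutLabelled (discrete G) l v y) ]
                                     proj₁ (include a) ≈E proj₁ b
        strictlySurjective (e , oe≈v , le≡y) =
          (f , proj₂ (π (o e) v oe≈v (e , refl)) , trans (sym (l-cong (t-cong e≈f))) le≡y)
          , EE.sym e≈f
          where
          f : E
          f = proj₁ (π (o e) v oe≈v (e , refl))
          e≈f : e ≈E f
          e≈f = ≈E-π e oe≈v

      OutLabelsEq-discrete : ∀ {v M} → OutLabelsEq ∼ l v M → OutLabelsEq (discrete G) l v M
      OutLabelsEq-discrete {v} count y =
        Composition.bijection (OutLabelled-discrete⤖quotient v y) (count y)

lemma7 : (G : Graph) (R : Graph.V G) → Rooted G R →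
    (∼ : GraphEquiv G) → NEC ∼ →
    ActualLabelling ∼ R →
    ActualLabelling (discrete G) R
lemma7 G R rooted ∼ nec AL = record
  { noInRoot = λ e t≡R → noInRoot e (reflexive t≡R)
  ; k = k ; l = l ; l-cong = cong l ; lp = lp ; lp-cong = cong lp ; M = M
  ; cond1 = λ v v≢R → cond1 v (non-root v≢R)
  ; cond2 = λ v v≢R → OutLabelsEq-discrete l-cong (cond2 v (non-root v≢R))
  ; cond3 = λ e _ → cond3 e (noInRoot e)
  ; cond4 = OutLabelsEq-discrete l-cong cond4
  }
  where
  open GraphEquiv ∼ using (_≈V_; isEqV)
  open IsEquivalence isEqV using (reflexive)
  open ActualLabelling AL
  open NonEdgeCollapsing ∼ nec
  non-root : ∀ {v} → v ≢ R → ¬ (v ≈V R)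
  non-root = ¬≈root ∼ rooted noInRoot
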